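{- A finite simple graph $G$ (with at least one vertex) is $\zeta$-regular if and only if $\max_{K\subseteq G} \delta(K)=\delta(G)$, where the maximum is over all (nonempty) subgraphs $K$ of $G$.
   Context: For a vertex $v$ of $G$, $\zeta_G(v)=\max_{H} \delta(H)$, the maximum over all subgraphs $H$ of $G$ containing $v$, where $\delta(H)$ is the minimum degree of $H$. $G$ is called $\zeta$-regular if $\zeta_G(u)=\zeta_G(v)$ for all vertices $u,v$ of $G$. -}

module Defs where

open import Data.Nat using (ℕ; zero; suc; _≤_)
open import Data.Nat.ListAction using (sum)
open import Data.Bool using (Bool; true; false; if_then_else_)
open import Data.Fin using (Fin)
open import Data.List using (map; allFin)
open import Data.Product using (Σ; ∃; _×_)
open import Relation.Binary.PropositionalEquality using (_≡_)

record Graph (n : ℕ) : Set where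
  field
    adj    : Fin n → Fin n → Bool
    sym    : ∀ u v → adj u v ≡ adj v u
    irrefl : ∀ v → adj v v ≡ false
open Graph public

record Subgraph {n : ℕ} (G : Graph n) : Set where
  field
    vert     : Fin n → Bool
    edge     : Fin n → Fin n → Bool
    edge-sym : ∀ u v → edge u v ≡ edge v u
    edge⊆adj : ∀ u v → edge u v ≡ true → adj G u v ≡ true
    edge⊆vert : ∀ u v → edge u v ≡ true → vert u ≡ true
open Subgraph public

whole : ∀ {n} (G : Graph n) → Subgraph G
whole G = record
  { vert = λ _ → true
  ; edge = adj G
  ; edge-sym = sym G
  ; edge⊆adj = λ _ _ e → e
  ; edge⊆vert = λ _ _ _ → _≡_.refl
  }

deg : ∀ {n} {G : Graph n} → Subgraph G → Fin n → ℕ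
deg {n} H v = sum (map (λ w → if edge H v w then 1 else 0) (allFin n))

Nonempty : ∀ {n} {G : Graph n} → Subgraph G → Set
Nonempty H = ∃ λ v → vert H v ≡ true

IsMinDeg : ∀ {n} {G : Graph n} → Subgraph G → ℕ → Set
IsMinDeg H d =
  (∃ λ v → vert H v ≡ true × deg H v ≡ d) ×
  (∀ v → vert H v ≡ true → d ≤ deg H v)

IsZeta : ∀ {n} (G : Graph n) → Fin n → ℕ → Set
IsZeta G v k =
  (Σ (Subgraph G) λ H → vert H v ≡ true × IsMinDeg H k) ×
  (∀ (H : Subgraph G) d → vert H v ≡ true → IsMinDeg H d → d ≤ k)

ZetaRegular : ∀ {n} (G : Graph n) → Set
ZetaRegular G = ∀ u v k l → IsZeta G u k → IsZeta G v l → k ≡ l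

IsMaxMinDeg : ∀ {n} (G : Graph n) → ℕ → Set
IsMaxMinDeg G m =
  (Σ (Subgraph G) λ K → Nonempty K × IsMinDeg K m) ×
  (∀ (K : Subgraph G) d → Nonempty K → IsMinDeg K d → d ≤ m)

MinDegree : ∀ {n} (G : Graph n) → ℕ → Set
MinDegree G d = IsMinDeg (whole G) d

MaxMinDegEqMinDeg : ∀ {n} (G : Graph n) → Set
MaxMinDegEqMinDeg G = ∀ m d → IsMaxMinDeg G m → MinDegree G d → m ≡ d

-- Since G contains every vertex, and every subgraph containing a vertex is
-- nonempty, δ(G) ≤ ζ(v) ≤ max_K δ(K) for all v; if the two bounds agree, ζ is
-- constant. Conversely, ζ equals the maximum at a vertex of a maximising
-- subgraph, and equals δ(G) at a vertex of minimum degree, since deleting edges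
-- or vertices never increases a degree; ζ-regularity identifies the two values.
-- Constructively, both extremal values have to be found: δ(H) is the greatest
-- lower bound of the degrees of H, and max_K δ(K) the greatest k such that some
-- nonempty vertex set induces a subgraph of minimum degree ≥ k, each obtained by
-- a bounded search over a decidable predicate.
module Submission where

open import Defs hiding (sym)
open import Data.Nat using (ℕ; zero; suc; _≤_; _≤?_; z≤n; s≤s)
open import Data.Nat.Properties
  using (≤-trans; ≤-antisym; +-mono-≤; m≤n⇒m≤1+n; ≤∧≢⇒<; m<1+n⇒m≤n; ≮⇒≥; 1+n≰n)
open import Data.Nat.ListAction using (sum)
open import Data.Bool using (Bool; true; false; if_then_else_; _∧_)
open import Data.Bool.Properties using (_≟_)
open import Data.Fin using (Fin; zero)
open import Data.Fin.Properties using (any?; all?; ¬∀⟶∃¬)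
open import Data.Fin.Subset using (Subset)
open import Data.Fin.Subset.Properties using (anySubset?)
open import Data.List using (List; []; _∷_; map; length; allFin)
open import Data.List.Properties using (length-tabulate)
open import Data.Vec using (lookup; tabulate)
open import Data.Vec.Properties using (lookup∘tabulate)
open import Data.Product using (∃; _×_; _,_; proj₂)
open import Data.Empty using (⊥-elim)
open import Relation.Nullary using (Dec; yes; no)
open import Relation.Nullary.Decidable using (_×-dec_; _→-dec_)
open import Relation.Unary using (Pred; Decidable)
open import Relation.Binary.PropositionalEquality using (_≡_; refl; sym; trans; subst)

countTrue : ∀ {A : Set} → (A → Bool) → List A → ℕ
countTrue f xs = sum (map (λ x → if f x then 1 else 0) xs)

countTrue-mono : ∀ {A : Set} (f g : A → Bool) (xs : List A) →
  (∀ x → f x ≡ true → g x ≡ true) → countTrue f xs ≤ countTrue g xs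
countTrue-mono f g [] f⊆g = z≤n
countTrue-mono f g (x ∷ xs) f⊆g with f x in fx
... | true rewrite f⊆g x fx = s≤s (countTrue-mono f g xs f⊆g)
... | false = +-mono-≤ z≤n (countTrue-mono f g xs f⊆g)

countTrue≤length : ∀ {A : Set} (f : A → Bool) (xs : List A) → countTrue f xs ≤ length xs
countTrue≤length f [] = z≤n
countTrue≤length f (x ∷ xs) with f x
... | true = s≤s (countTrue≤length f xs)
... | false = m≤n⇒m≤1+n (countTrue≤length f xs)

module _ {p} {P : Pred ℕ p} (P? : Decidable P) where

  greatest : P 0 → ∀ b → (∀ k → P k → k ≤ b) → ∃ λ k → P k × (∀ j → P j → j ≤ k)
  greatest P0 zero bounded = 0 , P0 , bounded
  greatest P0 (suc b) bounded with P? (suc b)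
  ... | yes Pb = suc b , Pb , bounded
  ... | no ¬Pb = greatest P0 b λ k Pk →
    m<1+n⇒m≤n (≤∧≢⇒< (bounded k Pk) λ { refl → ¬Pb Pk })

module _ {n : ℕ} {G : Graph n} where

  deg-mono : (H H′ : Subgraph G) (v : Fin n) →
    (∀ w → edge H v w ≡ true → edge H′ v w ≡ true) → deg H v ≤ deg H′ v
  deg-mono H H′ v = countTrue-mono (edge H v) (edge H′ v) (allFin n)

  deg≤n : (H : Subgraph G) (v : Fin n) → deg H v ≤ n
  deg≤n H v = subst (deg H v ≤_) (length-tabulate {n = n} (λ i → i))
    (countTrue≤length (edge H v) (allFin n))

  deg≤deg-whole : (H : Subgraph G) (v : Fin n) → deg H v ≤ deg (whole G) v
  deg≤deg-whole H v = deg-mono H (whole G) v (edge⊆adj H v)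

  MinDeg≥ : Subgraph G → ℕ → Set
  MinDeg≥ H k = ∀ v → vert H v ≡ true → k ≤ deg H v

  minDeg≥? : (H : Subgraph G) → Decidable (MinDeg≥ H)
  minDeg≥? H k = all? λ v → (vert H v ≟ true) →-dec (k ≤? deg H v)

  nonempty? : (H : Subgraph G) → Dec (Nonempty H)
  nonempty? H = any? λ v → vert H v ≟ true

  minDeg-exists : (H : Subgraph G) → Nonempty H → ∃ (IsMinDeg H)
  minDeg-exists H (w , w∈H)
    with greatest (minDeg≥? H) (λ _ _ → z≤n) (deg H w) (λ _ lower → lower w w∈H)
  ... | d , lower , greatestLower
    with ¬∀⟶∃¬ n _ (λ v → (vert H v ≟ true) →-dec (suc d ≤? deg H v))
                   (λ lower′ → 1+n≰n (greatestLower (suc d) lower′))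
  ... | v , ¬lower[v] with vert H v in v∈H
  ...   | false = ⊥-elim (¬lower[v] λ ())
  ...   | true = d , (v , v∈H , ≤-antisym (≮⇒≥ λ d<deg → ¬lower[v] λ _ → d<deg)
                                          (lower v v∈H)) , lower

  induced : (Fin n → Bool) → Subgraph G
  induced S = record
    { vert = S
    ; edge = λ u v → S u ∧ (S v ∧ adj G u v)
    ; edge-sym = edge-sym′
    ; edge⊆adj = edge⊆adj′
    ; edge⊆vert = edge⊆vert′
    }
    where
    edge-sym′ : ∀ u v → S u ∧ (S v ∧ adj G u v) ≡ S v ∧ (S u ∧ adj G v u)
    edge-sym′ u v rewrite Graph.sym G u v with S u | S v
    ... | true  | _     = refl
    ... | false | true  = refl
    ... | false | false = refl
    edge⊆adj′ : ∀ u v → S u ∧ (S v ∧ adj G u v) ≡ true → adj G u v ≡ true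
    edge⊆adj′ u v e with S u | S v
    ... | true | true = e
    edge⊆vert′ : ∀ u v → S u ∧ (S v ∧ adj G u v) ≡ true → S u ≡ true
    edge⊆vert′ u v e with S u
    ... | true = refl

  edge⊆induced : (K : Subgraph G) (S : Fin n → Bool) → (∀ v → vert K v ≡ true → S v ≡ true) →
    ∀ v w → edge K v w ≡ true → edge (induced S) v w ≡ true
  edge⊆induced K S K⊆S v w e
    rewrite K⊆S v (edge⊆vert K v w e)
          | K⊆S w (edge⊆vert K w v (trans (edge-sym K w v) e)) = edge⊆adj K v w e

  -- Vertex sets are taken as vectors so that anySubset? can enumerate them.
  HasDenseSubset : ℕ → Set
  HasDenseSubset k = ∃ λ (S : Subset n) → Nonempty (induced (lookup S)) × MinDeg≥ (induced (lookup S)) k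

  hasDenseSubset? : Decidable HasDenseSubset
  hasDenseSubset? k = anySubset? λ S →
    nonempty? (induced (lookup S)) ×-dec minDeg≥? (induced (lookup S)) k

  hasDenseSubset : (K : Subgraph G) {k : ℕ} → Nonempty K → MinDeg≥ K k → HasDenseSubset k
  hasDenseSubset K (w , w∈K) K≥k =
    S , (w , trans (lookup∘tabulate (vert K) w) w∈K) , λ v v∈S →
      let v∈K = trans (sym (lookup∘tabulate (vert K) v)) v∈S in
      ≤-trans (K≥k v v∈K) (deg-mono K (induced (lookup S)) v (edge⊆induced K (lookup S) K⊆S v))
    where
    S = tabulate (vert K)
    K⊆S : ∀ v → vert K v ≡ true → lookup S v ≡ true
    K⊆S v v∈K = trans (lookup∘tabulate (vert K) v) v∈K

  maxMinDeg-exists : Fin n → ∃ (IsMaxMinDeg G)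
  maxMinDeg-exists v
    with greatest hasDenseSubset? (hasDenseSubset (whole G) (v , refl) (λ _ _ → z≤n)) n
                  (λ { k (S , (w , w∈S) , S≥k) → ≤-trans (S≥k w w∈S) (deg≤n (induced (lookup S)) w) })
  ... | m , (S , ne , S≥m) , greatestDense with minDeg-exists (induced (lookup S)) ne
  -- δ of the subgraph induced by S is at least m, and every δ(K) is at most m
  -- because the vertex set of K is dense at level δ(K).
  ... | d , md@((w , w∈S , deg≡d) , _) =
    d , (induced (lookup S) , ne , md) , λ K d′ neK mdK →
      ≤-trans (greatestDense d′ (hasDenseSubset K neK (proj₂ mdK)))
              (subst (m ≤_) deg≡d (S≥m w w∈S))

  minDegree-exists : Fin n → ∃ (MinDegree G)
  minDegree-exists v = minDeg-exists (whole G) (v , refl)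

  zeta-at-maximiser : ∀ {m} → IsMaxMinDeg G m → ∃ λ w → IsZeta G w m
  zeta-at-maximiser ((K , (w , w∈K) , mdK) , maximal) =
    w , (K , w∈K , mdK) , λ H d w∈H mdH → maximal H d (w , w∈H) mdH

  zeta-at-minimiser : ∀ {d} → MinDegree G d → ∃ λ v → IsZeta G v d
  zeta-at-minimiser md@((v , _ , deg≡d) , _) =
    v , (whole G , refl , md) , λ H d′ v∈H mdH →
      ≤-trans (proj₂ mdH v v∈H) (subst (deg H v ≤_) deg≡d (deg≤deg-whole H v))

  minDeg≤zeta : ∀ {d v k} → MinDegree G d → IsZeta G v k → d ≤ k
  minDeg≤zeta md (_ , maximal) = maximal (whole G) _ refl md

  zeta≤maxMinDeg : ∀ {m v k} → IsMaxMinDeg G m → IsZeta G v k → k ≤ m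
  zeta≤maxMinDeg (_ , maximal) ((H , v∈H , mdH) , _) = maximal H _ (_ , v∈H) mdH

  max≡min⇒regular : Fin n → MaxMinDegEqMinDeg G → ZetaRegular G
  max≡min⇒regular v₀ max≡min = regular (maxMinDeg-exists v₀) (minDegree-exists v₀)
    where
    regular : ∃ (IsMaxMinDeg G) → ∃ (MinDegree G) → ZetaRegular G
    regular (m , max) (d , min) u v k l ζu ζv = trans (ζ≡δ ζu) (sym (ζ≡δ ζv))
      where
      ζ≡δ : ∀ {w k} → IsZeta G w k → k ≡ d
      ζ≡δ {k = k} ζ = ≤-antisym (subst (k ≤_) (max≡min m d max min) (zeta≤maxMinDeg max ζ))
                                (minDeg≤zeta min ζ)

  regular⇒max≡min : ZetaRegular G → MaxMinDegEqMinDeg G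
  regular⇒max≡min regular m d max min
    with zeta-at-maximiser max | zeta-at-minimiser min
  ... | w , ζw | v , ζv = regular w v m d ζw ζv

lemma1 : (n : ℕ) (G : Graph (suc n)) →
    (ZetaRegular G → MaxMinDegEqMinDeg G) × (MaxMinDegEqMinDeg G → ZetaRegular G)
lemma1 n G = regular⇒max≡min , max≡min⇒regular zero
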